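{- Let $n$ be a positive even integer and $T$ an $n$-tournament with vertices $v_1,\dots,v_n$ such that $T[X]$ is transitive, where $X=\{v_1,\dots,v_{n-1}\}$, and let $\psi_T(v_n,X)=(\alpha_1,\dots,\alpha_t)$. Then $\det(T)\le (n-1)^2$, with equality if and only if $t=n-1$.
   Context: A tournament is a directed graph with exactly one arc between each pair of distinct vertices; $u\rightarrow v$ means the arc goes from $u$ to $v$; $T[X]$ is the subtournament induced by $X$; a tournament is transitive if it has no directed 3-cycle. For a tournament $T$ on vertices $w_1,\dots,w_n$, its skew-adjacency matrix is the zero-diagonal matrix $S_T=[s_{ij}]$ with $s_{ij}=-s_{ji}=1$ if $w_i\rightarrow w_j$, and $\det(T):=\det(S_T)$. Definition of $\psi$: if $T[X]$ is transitive with $|X|=k$, order $X$ as $x_1,\dots,x_k$ with $x_a\rightarrow x_b$ for $a<b$. For $u\notin X$, $\psi_T(u,X)=(\alpha_1,\dots,\alpha_t)$ is the sequence of nonzero integers with $|\alpha_1|+\dots+|\alpha_t|=k$ and $\alpha_i\alpha_{i+1}<0$ for $1\le i\le t-1$, such that, with $X(i,\alpha_i)$ the $i$-th block of $|\alpha_i|$ consecutive vertices of $x_1,\dots,x_k$, $u$ dominates every vertex of $X(i,\alpha_i)$ if $\alpha_i>0$ and is dominated by every vertex of $X(i,\alpha_i)$ if $\alpha_i<0$ (i.e., the blocks are the maximal runs of consecutive vertices on which the direction of the arcs with $u$ is constant). -}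

module Defs where

open import Data.Bool using (Bool; true; false; if_then_else_; not)
open import Data.Nat using (ℕ; zero; suc)
open import Data.Integer using (ℤ; +_; -_; _+_; _*_)
open import Data.Fin using (Fin; zero; suc; punchIn; inject₁; fromℕ; _<_)
open import Data.List using (List; []; _∷_; length)
open import Data.Product using (_×_)
open import Data.Empty using (⊥)
open import Relation.Nullary using (¬_)
open import Relation.Binary.PropositionalEquality using (_≡_; _≢_)

-- A tournament on the vertex set Fin n: T u v ≡ true means the arc u → v.
record IsTournament {n : ℕ} (T : Fin n → Fin n → Bool) : Set where
  field
    irrefl : ∀ u → T u u ≡ false
    oneArc : ∀ u v → u ≢ v → T u v ≡ not (T v u)

skew : ∀ {n} → (Fin n → Fin n → Bool) → Fin n → Fin n → ℤ
skew T i j = if T i j then + 1 else (if T j i then - (+ 1) else + 0)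

sumFin : ∀ n → (Fin n → ℤ) → ℤ
sumFin zero f = + 0
sumFin (suc n) f = f zero + sumFin n (λ i → f (suc i))

altSumFin : ∀ n → (Fin n → ℤ) → ℤ
altSumFin zero f = + 0
altSumFin (suc n) f = f zero + - altSumFin n (λ i → f (suc i))

det : ∀ n → (Fin n → Fin n → ℤ) → ℤ
det zero M = + 1
det (suc n) M = altSumFin (suc n) (λ j → M zero j * det n (λ i k → M (suc i) (punchIn j k)))

detT : ∀ {n} → (Fin n → Fin n → Bool) → ℤ
detT {n} T = det n (skew T)

TransitiveOn : ∀ {n} → (Fin n → Bool) → (Fin n → Fin n → Bool) → Set
TransitiveOn X T = ∀ a b c → X a ≡ true → X b ≡ true → X c ≡ true →
  ¬ (T a b ≡ true × T b c ≡ true × T c a ≡ true)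

-- The first n-1 vertices (X = {v_1,...,v_{n-1}} for n = suc m).
inFirst : ∀ {m} → Fin (suc m) → Bool
inFirst {zero} zero = false
inFirst {suc m} zero = true
inFirst {suc m} (suc i) = inFirst {m} i

-- Run-length encoding of a sign sequence into signed block lengths:
-- a maximal run of k 'true's (u dominates) gives + k, of k 'false's gives - k.
runsAux : Bool → ℕ → List Bool → List ℤ
runsAux b k [] = (if b then + (suc k) else - (+ (suc k))) ∷ []
runsAux b k (c ∷ cs) with b | c
... | true  | true  = runsAux b (suc k) cs
... | false | false = runsAux b (suc k) cs
... | _     | _     = (if b then + (suc k) else - (+ (suc k))) ∷ runsAux c zero cs

runs : List Bool → List ℤ
runs [] = []
runs (b ∷ bs) = runsAux b zero bs

finList : ∀ m {A : Set} → (Fin m → A) → List A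
finList zero f = []
finList (suc m) f = f zero ∷ finList m (λ i → f (suc i))

-- ψ_T(u, X) where X is given by its transitive ordering σ : Fin m → Fin (suc m)
-- (x_a = σ a, with x_a → x_b for a < b).
psi : ∀ {n} m → (Fin n → Fin n → Bool) → Fin n → (Fin m → Fin n) → List ℤ
psi m T u σ = runs (finList m (λ a → T u (σ a)))

-- Listing the vertices as v_n, x_1, …, x_{n-1} turns S_T into the bordered matrix [[0, r], [-r, A]],
-- where A is the skew matrix of the transitive tournament (A_ij = sign (j - i)) and r_j = ±1 according
-- as v_n dominates x_j or not. Expanding along the first row, every minor is A with one column deleted
-- and a column c prepended; as n - 1 is odd, row reduction shows that each of them has determinant
-- Σ (-1)^i c_i. Hence det T = s² with s = Σ (-1)^j r_j. If p of the signs (-1)^j r_j are +1 and q are -1,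
-- then (n - 1)² - det T = (p + q)² - (p - q)² = 4pq ≥ 0, with equality iff these signs all agree, that is,
-- iff r alternates, that is, iff ψ_T(v_n, X) has n - 1 blocks.
module Submission where

open import Defs
open import Data.Bool using (Bool; true; false; not; _xor_)
open import Data.Nat as ℕ using (ℕ; zero; suc; s≤s)
import Data.Nat.Properties as ℕₚ
open import Data.Nat.Divisibility using (_∣_; divides)
open import Data.Integer using (ℤ; +_; -_; _+_; _*_; _≤_; -1ℤ)
open import Data.Integer using () renaming (_*_ to _*ℤ_)
import Data.Integer.Properties as ℤₚ
open import Algebra.Properties.Ring ℤₚ.+-*-ring using (+-identityʳ-unique)
open import Data.Integer.Tactic.RingSolver using (solve-∀)
open import Data.Fin using (Fin; zero; suc; punchIn; punchOut; inject₁; lift; fromℕ; _<_; _≟_)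
open import Data.Fin.Properties
  using (suc-injective; punchInᵢ≢i; punchIn-injective; punchIn-punchOut; punchOut-injective; <-cmp)
open import Data.List using (List; []; _∷_; _++_; map; length)
open import Data.Product using (Σ-syntax; _×_; _,_; proj₁; proj₂)
open import Function using (id; _∘_; flip)
open import Function.Bundles using (_⇔_; mk⇔)
open import Function.Definitions using (Injective)
open import Function.Properties.Equivalence using () renaming (trans to ⇔-trans; sym to ⇔-sym)
open import Relation.Binary.Definitions using (tri<; tri≈; tri>)
open import Relation.Binary.PropositionalEquality
open import Relation.Nullary using (yes; no; contradiction)

-- Alternating sums and parity

altSumFin-cong : ∀ n {f g : Fin n → ℤ} → (∀ i → f i ≡ g i) → altSumFin n f ≡ altSumFin n g
altSumFin-cong zero    f≗g = refl
altSumFin-cong (suc n) f≗g = cong₂ (λ a s → a + - s) (f≗g zero) (altSumFin-cong n (f≗g ∘ suc))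

altSumFin-zero : ∀ n (f : Fin n → ℤ) → (∀ i → f i ≡ + 0) → altSumFin n f ≡ + 0
altSumFin-zero n f f≗0 = trans (altSumFin-cong n f≗0) (lemma n)
  where
  lemma : ∀ n → altSumFin n (λ _ → + 0) ≡ + 0
  lemma zero    = refl
  lemma (suc n) = cong (λ s → + 0 + - s) (lemma n)

altSumFin-+ : ∀ n (f g : Fin n → ℤ) →
              altSumFin n (λ i → f i + g i) ≡ altSumFin n f + altSumFin n g
altSumFin-+ zero    f g = refl
altSumFin-+ (suc n) f g =
  trans (cong (λ s → f zero + g zero + - s) (altSumFin-+ n (f ∘ suc) (g ∘ suc)))
        (interchange (f zero) (g zero) _ _)
  where
  interchange : ∀ a b c d → a + b + - (c + d) ≡ (a + - c) + (b + - d)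
  interchange = solve-∀

altSumFin-neg : ∀ n (f : Fin n → ℤ) → altSumFin n (λ i → - f i) ≡ - altSumFin n f
altSumFin-neg zero    f = refl
altSumFin-neg (suc n) f =
  trans (cong (λ s → - f zero + - s) (altSumFin-neg n (f ∘ suc)))
        (sym (ℤₚ.neg-distrib-+ (f zero) _))

altSumFin-*ˡ : ∀ n c (f : Fin n → ℤ) → altSumFin n (λ i → c * f i) ≡ c * altSumFin n f
altSumFin-*ˡ zero    c f = sym (ℤₚ.*-zeroʳ c)
altSumFin-*ˡ (suc n) c f =
  trans (cong (λ s → c * f zero + - s) (altSumFin-*ˡ n c (f ∘ suc))) (factor c _ _)
  where
  factor : ∀ c a b → c * a + - (c * b) ≡ c * (a + - b)
  factor = solve-∀

data Even : ℕ → Set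
data Odd : ℕ → Set

data Even where
  zero : Even zero
  suc  : ∀ {n} → Odd n → Even (suc n)

data Odd where
  suc : ∀ {n} → Even n → Odd (suc n)

altSumFin-const-even : ∀ {n} → Even n → ∀ x → altSumFin n (λ _ → x) ≡ + 0
altSumFin-const-odd  : ∀ {n} → Odd n → ∀ x → altSumFin n (λ _ → x) ≡ x

altSumFin-const-even zero    x = refl
altSumFin-const-even (suc o) x = trans (cong (λ s → x + - s) (altSumFin-const-odd o x)) (ℤₚ.+-inverseʳ x)

altSumFin-const-odd (suc e) x = trans (cong (λ s → x + - s) (altSumFin-const-even e x)) (ℤₚ.+-identityʳ x)

even-*2 : ∀ q → Even (q ℕ.* 2)
even-*2 ℕ.zero    = zero
even-*2 (ℕ.suc q) = suc (suc (even-*2 q))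

2∣⇒Even : ∀ {k} → 2 ∣ k → Even k
2∣⇒Even (divides q refl) = even-*2 q

-- Determinants under adjacent transpositions

Mat : ℕ → Set
Mat n = Fin n → Fin n → ℤ

det-cong : ∀ n {M N : Mat n} → (∀ i j → M i j ≡ N i j) → det n M ≡ det n N
det-cong zero    M≗N = refl
det-cong (suc n) M≗N = altSumFin-cong (suc n) λ j →
  cong₂ _*_ (M≗N zero j) (det-cong n (λ i k → M≗N (suc i) (punchIn j k)))

minor : ∀ {n} → Mat (suc n) → Fin (suc n) → Mat n
minor M j i k = M (suc i) (punchIn j k)

alternate-exchange : ∀ x y s → y + - (x + - - s) ≡ - (x + - (y + - s))
alternate-exchange = solve-∀

pairSum : ∀ n → (Fin (suc n) → Fin (suc n) → ℤ) → ℤ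
pairSum n h = altSumFin (suc n) (λ a → altSumFin n (λ k → h a (punchIn a k)))

pairSum-suc : ∀ n (h : Fin (suc (suc n)) → Fin (suc (suc n)) → ℤ) →
  pairSum (suc n) h ≡
    altSumFin (suc n) (λ k → h zero (suc k))
    + - (altSumFin (suc n) (λ a → h (suc a) zero) + - pairSum n (λ a b → h (suc a) (suc b)))
pairSum-suc n h = cong (λ s → altSumFin (suc n) (λ k → h zero (suc k)) + - s) (begin
  altSumFin (suc n) (λ a → h (suc a) zero + - inner a)
    ≡⟨ altSumFin-+ (suc n) (λ a → h (suc a) zero) (λ a → - inner a) ⟩
  altSumFin (suc n) (λ a → h (suc a) zero) + altSumFin (suc n) (λ a → - inner a)
    ≡⟨ cong (λ s → altSumFin (suc n) (λ a → h (suc a) zero) + s) (altSumFin-neg (suc n) inner) ⟩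
  altSumFin (suc n) (λ a → h (suc a) zero) + - pairSum n (λ a b → h (suc a) (suc b)) ∎)
  where
  open ≡-Reasoning
  inner : Fin (suc n) → ℤ
  inner a = altSumFin n (λ k → h (suc a) (suc (punchIn a k)))

pairSum-flip : ∀ n (h : Fin (suc n) → Fin (suc n) → ℤ) → pairSum n (flip h) ≡ - pairSum n h
pairSum-flip zero    h = refl
pairSum-flip (suc n) h = begin
  pairSum (suc n) (flip h)
    ≡⟨ pairSum-suc n (flip h) ⟩
  col + - (row + - pairSum n (flip h′))
    ≡⟨ cong (λ s → col + - (row + - s)) (pairSum-flip n h′) ⟩
  col + - (row + - - pairSum n h′)
    ≡⟨ alternate-exchange row col (pairSum n h′) ⟩
  - (row + - (col + - pairSum n h′))
    ≡⟨ cong -_ (pairSum-suc n h) ⟨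
  - pairSum (suc n) h ∎
  where
  open ≡-Reasoning
  h′ = λ a b → h (suc a) (suc b)
  row = altSumFin (suc n) (λ k → h zero (suc k))
  col = altSumFin (suc n) (λ a → h (suc a) zero)

-- A total punchOut; the value of punchOut′ a a is junk.
punchOut′ : ∀ {n} → Fin (suc (suc n)) → Fin (suc (suc n)) → Fin (suc n)
punchOut′ zero    zero    = zero
punchOut′ zero    (suc b) = b
punchOut′ {zero}  (suc a) b = zero
punchOut′ {suc n} (suc a) zero = zero
punchOut′ {suc n} (suc a) (suc b) = suc (punchOut′ a b)

punchOut′-punchIn : ∀ {n} (a : Fin (suc (suc n))) k → punchOut′ a (punchIn a k) ≡ k
punchOut′-punchIn zero    k = refl
punchOut′-punchIn {zero}  (suc a) zero    = refl
punchOut′-punchIn {suc n} (suc a) zero    = refl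
punchOut′-punchIn {suc n} (suc a) (suc k) = cong suc (punchOut′-punchIn a k)

-- The increasing enumeration of Fin (2 + n) without a and b.
punchIn₂ : ∀ {n} → Fin (suc (suc n)) → Fin (suc (suc n)) → Fin n → Fin (suc (suc n))
punchIn₂ a b = punchIn a ∘ punchIn (punchOut′ a b)

punchIn₂-sym : ∀ {n} {a b : Fin (suc (suc n))} → a ≢ b → ∀ l → punchIn₂ a b l ≡ punchIn₂ b a l
punchIn₂-sym {a = zero}  {zero}  a≢b l = contradiction refl a≢b
punchIn₂-sym {suc n} {zero}  {suc b} a≢b l       = refl
punchIn₂-sym {suc n} {suc a} {zero}  a≢b l       = refl
punchIn₂-sym {suc n} {suc a} {suc b} a≢b zero    = refl
punchIn₂-sym {suc n} {suc a} {suc b} a≢b (suc l) = cong suc (punchIn₂-sym (a≢b ∘ cong suc) l)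

det-expand₂ : ∀ n (M : Mat (suc (suc n))) →
  det (suc (suc n)) M ≡
    pairSum (suc n) (λ a b → M zero a * (M (suc zero) b * det n (λ i l → M (suc (suc i)) (punchIn₂ a b l))))
det-expand₂ n M = altSumFin-cong (suc (suc n)) λ a →
  trans (sym (altSumFin-*ˡ (suc n) (M zero a) (λ k → M (suc zero) (punchIn a k) * det n (minor (minor M a) k))))
        (altSumFin-cong (suc n) λ k →
    cong (λ b → M zero a * (M (suc zero) (punchIn a k) * det n (λ i l → M (suc (suc i)) (punchIn a (punchIn b l)))))
         (sym (punchOut′-punchIn a k)))

swapAdj : ∀ {n} → Fin n → Fin (suc n) → Fin (suc n)
swapAdj zero    zero          = suc zero
swapAdj zero    (suc zero)    = zero
swapAdj zero    (suc (suc i)) = suc (suc i)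
swapAdj (suc k) zero          = zero
swapAdj (suc k) (suc i)       = suc (swapAdj k i)

det-swapRows₀ : ∀ n (M : Mat (suc (suc n))) →
  det (suc (suc n)) (M ∘ swapAdj zero) ≡ - det (suc (suc n)) M
det-swapRows₀ n M = begin
  det (suc (suc n)) (M ∘ swapAdj zero)
    ≡⟨ det-expand₂ n (M ∘ swapAdj zero) ⟩
  pairSum (suc n) (λ a b → M (suc zero) a * (M zero b * D a b))
    ≡⟨ altSumFin-cong (suc (suc n)) (λ a → altSumFin-cong (suc n) (λ k → flipped a k)) ⟩
  pairSum (suc n) (flip h)
    ≡⟨ pairSum-flip (suc n) h ⟩
  - pairSum (suc n) h
    ≡⟨ cong -_ (det-expand₂ n M) ⟨
  - det (suc (suc n)) M ∎
  where
  open ≡-Reasoning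
  D : Fin (suc (suc n)) → Fin (suc (suc n)) → ℤ
  D a b = det n (λ i l → M (suc (suc i)) (punchIn₂ a b l))
  h : Fin (suc (suc n)) → Fin (suc (suc n)) → ℤ
  h a b = M zero a * (M (suc zero) b * D a b)
  exchange : ∀ x y d → x * (y * d) ≡ y * (x * d)
  exchange = solve-∀
  flipped : ∀ a k → M (suc zero) a * (M zero (punchIn a k) * D a (punchIn a k)) ≡ h (punchIn a k) a
  flipped a k =
    trans (exchange (M (suc zero) a) (M zero (punchIn a k)) (D a (punchIn a k)))
          (cong (λ d → M zero (punchIn a k) * (M (suc zero) a * d))
                (det-cong n (λ i l → cong (M (suc (suc i))) (punchIn₂-sym (punchInᵢ≢i a k ∘ sym) l))))

det-swapRows : ∀ n (k : Fin n) (M : Mat (suc n)) → det (suc n) (M ∘ swapAdj k) ≡ - det (suc n) M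
det-swapRows (suc n) zero    M = det-swapRows₀ n M
det-swapRows (suc n) (suc k) M = begin
  altSumFin (suc (suc n)) (λ j → M zero j * det (suc n) (minor M j ∘ swapAdj k))
    ≡⟨ altSumFin-cong (suc (suc n)) (λ j → cong (M zero j *_) (det-swapRows n k (minor M j))) ⟩
  altSumFin (suc (suc n)) (λ j → M zero j * - det (suc n) (minor M j))
    ≡⟨ altSumFin-cong (suc (suc n)) (λ j → ℤₚ.neg-distribʳ-* (M zero j) (det (suc n) (minor M j))) ⟨
  altSumFin (suc (suc n)) (λ j → - (M zero j * det (suc n) (minor M j)))
    ≡⟨ altSumFin-neg (suc (suc n)) (λ j → M zero j * det (suc n) (minor M j)) ⟩
  - det (suc (suc n)) M ∎
  where open ≡-Reasoning

swapAdj-inject₁ : ∀ {n} (k : Fin n) → swapAdj k (inject₁ k) ≡ suc k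
swapAdj-inject₁ zero    = refl
swapAdj-inject₁ (suc k) = cong suc (swapAdj-inject₁ k)

swapAdj-suc : ∀ {n} (k : Fin n) → swapAdj k (suc k) ≡ inject₁ k
swapAdj-suc zero    = refl
swapAdj-suc (suc k) = cong suc (swapAdj-suc k)

swapAdj-fixed : ∀ {n} (k : Fin n) {j} → j ≢ inject₁ k → j ≢ suc k → swapAdj k j ≡ j
swapAdj-fixed zero    {zero}          j≢k j≢k+1 = contradiction refl j≢k
swapAdj-fixed zero    {suc zero}      j≢k j≢k+1 = contradiction refl j≢k+1
swapAdj-fixed zero    {suc (suc j)}   j≢k j≢k+1 = refl
swapAdj-fixed (suc k) {zero}          j≢k j≢k+1 = refl
swapAdj-fixed (suc k) {suc j}         j≢k j≢k+1 =
  cong suc (swapAdj-fixed k (j≢k ∘ cong suc) (j≢k+1 ∘ cong suc))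

swapAdj-punchIn-inject₁ : ∀ {n} (k l : Fin n) → swapAdj k (punchIn (inject₁ k) l) ≡ punchIn (suc k) l
swapAdj-punchIn-inject₁ zero    zero    = refl
swapAdj-punchIn-inject₁ zero    (suc l) = refl
swapAdj-punchIn-inject₁ (suc k) zero    = refl
swapAdj-punchIn-inject₁ (suc k) (suc l) = cong suc (swapAdj-punchIn-inject₁ k l)

swapAdj-punchIn-suc : ∀ {n} (k l : Fin n) → swapAdj k (punchIn (suc k) l) ≡ punchIn (inject₁ k) l
swapAdj-punchIn-suc zero    zero    = refl
swapAdj-punchIn-suc zero    (suc l) = refl
swapAdj-punchIn-suc (suc k) zero    = refl
swapAdj-punchIn-suc (suc k) (suc l) = cong suc (swapAdj-punchIn-suc k l)

swapAdj-punchIn : ∀ {n} (k : Fin (suc n)) {j : Fin (suc (suc n))} → j ≢ inject₁ k → j ≢ suc k →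
  Σ[ k′ ∈ Fin n ] (∀ l → swapAdj k (punchIn j l) ≡ punchIn j (swapAdj k′ l))
swapAdj-punchIn zero    {zero}       j≢k j≢k+1 = contradiction refl j≢k
swapAdj-punchIn zero    {suc zero}   j≢k j≢k+1 = contradiction refl j≢k+1
swapAdj-punchIn {suc n} zero {suc (suc j)} j≢k j≢k+1 = zero , λ
  { zero → refl ; (suc zero) → refl ; (suc (suc l)) → refl }
swapAdj-punchIn (suc k) {zero}       j≢k j≢k+1 = k , λ l → refl
swapAdj-punchIn {suc n} (suc k) {suc j} j≢k j≢k+1
  with k′ , commute ← swapAdj-punchIn k (j≢k ∘ cong suc) (j≢k+1 ∘ cong suc)
  = suc k′ , λ { zero → refl ; (suc l) → cong suc (commute l) }

altSumFin-swapAdj : ∀ n (k : Fin n) (f g : Fin (suc n) → ℤ) →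
  g (inject₁ k) ≡ f (suc k) → g (suc k) ≡ f (inject₁ k) →
  (∀ j → j ≢ inject₁ k → j ≢ suc k → g j ≡ - f j) →
  altSumFin (suc n) g ≡ - altSumFin (suc n) f
altSumFin-swapAdj (suc n) zero f g g₀ g₁ g-rest =
  trans (cong₂ (λ a b → a + - b) g₀ (cong₂ (λ b s → b + - s) g₁ rest))
        (alternate-exchange (f zero) (f (suc zero)) (altSumFin n (λ j → f (suc (suc j)))))
  where
  rest : altSumFin n (λ j → g (suc (suc j))) ≡ - altSumFin n (λ j → f (suc (suc j)))
  rest = trans (altSumFin-cong n (λ j → g-rest (suc (suc j)) (λ ()) (λ ())))
               (altSumFin-neg n (λ j → f (suc (suc j))))
altSumFin-swapAdj (suc n) (suc k) f g gₖ gₖ₊₁ g-rest =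
  trans (cong₂ (λ a s → a + - s) (g-rest zero (λ ()) (λ ()))
          (altSumFin-swapAdj n k (f ∘ suc) (g ∘ suc) gₖ gₖ₊₁
             (λ j j≢k j≢k+1 → g-rest (suc j) (j≢k ∘ suc-injective) (j≢k+1 ∘ suc-injective))))
        (sym (ℤₚ.neg-distrib-+ (f zero) (- altSumFin (suc n) (f ∘ suc))))

det-swapCols : ∀ n (k : Fin n) (M : Mat (suc n)) → det (suc n) (λ i → M i ∘ swapAdj k) ≡ - det (suc n) M
det-swapCols (suc n) k M = altSumFin-swapAdj (suc n) k term term′
  (cong₂ _*_ (cong (M zero) (swapAdj-inject₁ k))
             (det-cong (suc n) (λ i l → cong (M (suc i)) (swapAdj-punchIn-inject₁ k l))))
  (cong₂ _*_ (cong (M zero) (swapAdj-suc k))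
             (det-cong (suc n) (λ i l → cong (M (suc i)) (swapAdj-punchIn-suc k l))))
  untouched
  where
  term term′ : Fin (suc (suc n)) → ℤ
  term  j = M zero j * det (suc n) (minor M j)
  term′ j = M zero (swapAdj k j) * det (suc n) (λ i l → M (suc i) (swapAdj k (punchIn j l)))
  untouched : ∀ j → j ≢ inject₁ k → j ≢ suc k → term′ j ≡ - term j
  untouched j j≢k j≢k+1 with k′ , commute ← swapAdj-punchIn k j≢k j≢k+1 =
    trans (cong₂ _*_ (cong (M zero) (swapAdj-fixed k j≢k j≢k+1))
                     (trans (det-cong (suc n) (λ i l → cong (M (suc i)) (commute l)))
                            (det-swapCols n k′ (minor M j))))
          (sym (ℤₚ.neg-distribʳ-* (M zero j) (det (suc n) (minor M j))))

det-conj-swapAdj : ∀ n (k : Fin n) (M : Mat (suc n)) →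
  det (suc n) (λ i j → M (swapAdj k i) (swapAdj k j)) ≡ det (suc n) M
det-conj-swapAdj n k M = begin
  det (suc n) (λ i j → M (swapAdj k i) (swapAdj k j)) ≡⟨ det-swapRows n k (λ i → M i ∘ swapAdj k) ⟩
  - det (suc n) (λ i → M i ∘ swapAdj k)               ≡⟨ cong -_ (det-swapCols n k M) ⟩
  - - det (suc n) M                                    ≡⟨ ℤₚ.neg-involutive _ ⟩
  det (suc n) M                                        ∎
  where open ≡-Reasoning

-- Determinants under simultaneous permutations of rows and columns

swapsAdj : ∀ {n} → List (Fin n) → Fin (suc n) → Fin (suc n)
swapsAdj []       = id
swapsAdj (k ∷ ks) = swapAdj k ∘ swapsAdj ks

swapsAdj-++ : ∀ {n} (ks ls : List (Fin n)) x → swapsAdj (ks ++ ls) x ≡ swapsAdj ks (swapsAdj ls x)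
swapsAdj-++ []       ls x = refl
swapsAdj-++ (k ∷ ks) ls x = cong (swapAdj k) (swapsAdj-++ ks ls x)

swapsAdj-map-suc : ∀ {n} (ks : List (Fin n)) x → swapsAdj (map suc ks) x ≡ lift 1 (swapsAdj ks) x
swapsAdj-map-suc []       zero    = refl
swapsAdj-map-suc []       (suc x) = refl
swapsAdj-map-suc (k ∷ ks) x with swapsAdj-map-suc ks x
swapsAdj-map-suc (k ∷ ks) zero    | eq = cong (swapAdj (suc k)) eq
swapsAdj-map-suc (k ∷ ks) (suc x) | eq = cong (swapAdj (suc k)) eq

det-conj-swapsAdj : ∀ n (ks : List (Fin n)) (M : Mat (suc n)) →
  det (suc n) (λ i j → M (swapsAdj ks i) (swapsAdj ks j)) ≡ det (suc n) M
det-conj-swapsAdj n []       M = refl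
det-conj-swapsAdj n (k ∷ ks) M =
  trans (det-conj-swapsAdj n ks (λ i j → M (swapAdj k i) (swapAdj k j))) (det-conj-swapAdj n k M)

rotate : ∀ {n} → Fin (suc n) → Fin (suc n) → Fin (suc n)
rotate j zero    = j
rotate j (suc i) = punchIn j i

rotateSwaps : ∀ {n} → Fin (suc n) → List (Fin n)
rotateSwaps zero              = []
rotateSwaps {suc n} (suc j) = map suc (rotateSwaps j) ++ zero ∷ []

rotate-swapsAdj : ∀ {n} (j : Fin (suc n)) x → rotate j x ≡ swapsAdj (rotateSwaps j) x
rotate-swapsAdj zero    zero    = refl
rotate-swapsAdj zero    (suc x) = refl
rotate-swapsAdj {suc n} (suc j) x = sym (begin
  swapsAdj (map suc (rotateSwaps j) ++ zero ∷ []) x   ≡⟨ swapsAdj-++ (map suc (rotateSwaps j)) (zero ∷ []) x ⟩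
  swapsAdj (map suc (rotateSwaps j)) (swapAdj zero x) ≡⟨ swapsAdj-map-suc (rotateSwaps j) (swapAdj zero x) ⟩
  lift 1 (swapsAdj (rotateSwaps j)) (swapAdj zero x)  ≡⟨ step x ⟩
  rotate (suc j) x                                     ∎)
  where
  open ≡-Reasoning
  step : ∀ x → lift 1 (swapsAdj (rotateSwaps j)) (swapAdj zero x) ≡ rotate (suc j) x
  step zero          = cong suc (sym (rotate-swapsAdj j zero))
  step (suc zero)    = refl
  step (suc (suc x)) = cong suc (sym (rotate-swapsAdj j (suc x)))

-- Peeling off τ 0 by a rotation leaves an injection of Fin n.
injective⇒swapsAdj : ∀ n (τ : Fin (suc n) → Fin (suc n)) → Injective _≡_ _≡_ τ →
  Σ[ ks ∈ List (Fin n) ] (∀ x → τ x ≡ swapsAdj ks x)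
injective⇒swapsAdj zero τ τ-inj = [] , λ { zero → τ0≡0 }
  where
  τ0≡0 : τ zero ≡ zero
  τ0≡0 with τ zero
  ... | zero = refl
injective⇒swapsAdj (suc n) τ τ-inj = rotateSwaps (τ zero) ++ map suc (proj₁ rest) , decomposition
  where
  τ0≢τ-suc : ∀ i → τ zero ≢ τ (suc i)
  τ0≢τ-suc i eq with () ← τ-inj eq
  τ′ : Fin (suc n) → Fin (suc n)
  τ′ i = punchOut (τ0≢τ-suc i)
  τ′-inj : Injective _≡_ _≡_ τ′
  τ′-inj eq = suc-injective (τ-inj (punchOut-injective (τ0≢τ-suc _) (τ0≢τ-suc _) eq))
  rest = injective⇒swapsAdj n τ′ τ′-inj
  unrotate : ∀ x → rotate (τ zero) (lift 1 τ′ x) ≡ τ x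
  unrotate zero    = refl
  unrotate (suc x) = punchIn-punchOut (τ0≢τ-suc x)
  decomposition : ∀ x → τ x ≡ swapsAdj (rotateSwaps (τ zero) ++ map suc (proj₁ rest)) x
  decomposition x = sym (begin
    swapsAdj (rotateSwaps (τ zero) ++ map suc (proj₁ rest)) x
      ≡⟨ swapsAdj-++ (rotateSwaps (τ zero)) (map suc (proj₁ rest)) x ⟩
    swapsAdj (rotateSwaps (τ zero)) (swapsAdj (map suc (proj₁ rest)) x)
      ≡⟨ rotate-swapsAdj (τ zero) _ ⟨
    rotate (τ zero) (swapsAdj (map suc (proj₁ rest)) x)
      ≡⟨ cong (rotate (τ zero)) (swapsAdj-map-suc (proj₁ rest) x) ⟩
    rotate (τ zero) (lift 1 (swapsAdj (proj₁ rest)) x)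
      ≡⟨ cong (rotate (τ zero)) (lift1-cong x) ⟨
    rotate (τ zero) (lift 1 τ′ x)
      ≡⟨ unrotate x ⟩
    τ x ∎)
    where
    open ≡-Reasoning
    lift1-cong : ∀ x → lift 1 τ′ x ≡ lift 1 (swapsAdj (proj₁ rest)) x
    lift1-cong zero    = refl
    lift1-cong (suc x) = cong suc (proj₂ rest x)

det-conj-injective : ∀ n (τ : Fin n → Fin n) → Injective _≡_ _≡_ τ → (M : Mat n) →
  det n (λ i j → M (τ i) (τ j)) ≡ det n M
det-conj-injective zero    τ τ-inj M = refl
det-conj-injective (suc n) τ τ-inj M with ks , τ≗ks ← injective⇒swapsAdj n τ τ-inj =
  trans (det-cong (suc n) (λ i j → cong₂ M (τ≗ks i) (τ≗ks j))) (det-conj-swapsAdj n ks M)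

-- Column linearity and row reduction

punchIn≢ : ∀ {n} {j p : Fin (suc n)} (j≢p : j ≢ p) l → l ≢ punchOut j≢p → punchIn j l ≢ p
punchIn≢ {j = j} j≢p l l≢ eq =
  l≢ (punchIn-injective j l (punchOut j≢p) (trans eq (sym (punchIn-punchOut j≢p))))

det-linearCol : ∀ n (p : Fin n) (M M₁ M₂ : Mat n) →
  (∀ i l → l ≢ p → M i l ≡ M₁ i l) → (∀ i l → l ≢ p → M i l ≡ M₂ i l) →
  (∀ i → M i p ≡ M₁ i p + M₂ i p) → det n M ≡ det n M₁ + det n M₂
det-linearCol (suc n) p M M₁ M₂ M≗M₁ M≗M₂ Mp =
  trans (altSumFin-cong (suc n) term) (altSumFin-+ (suc n) (term₁ M₁) (term₁ M₂))
  where
  term₁ : Mat (suc n) → Fin (suc n) → ℤ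
  term₁ N j = N zero j * det n (minor N j)
  term : ∀ j → term₁ M j ≡ term₁ M₁ j + term₁ M₂ j
  term j with j ≟ p
  ... | yes refl = begin
    M zero j * det n (minor M j)
      ≡⟨ cong₂ _*_ (Mp zero) (det-cong n minor≗₁) ⟩
    (M₁ zero j + M₂ zero j) * det n (minor M₁ j)
      ≡⟨ ℤₚ.*-distribʳ-+ _ (M₁ zero j) (M₂ zero j) ⟩
    term₁ M₁ j + M₂ zero j * det n (minor M₁ j)
      ≡⟨ cong (λ d → term₁ M₁ j + M₂ zero j * d) (det-cong n minor₁≗₂) ⟩
    term₁ M₁ j + term₁ M₂ j ∎
    where
    open ≡-Reasoning
    minor≗₁ : ∀ i l → minor M j i l ≡ minor M₁ j i l
    minor≗₁ i l = M≗M₁ (suc i) (punchIn j l) (punchInᵢ≢i j l)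
    minor₁≗₂ : ∀ i l → minor M₁ j i l ≡ minor M₂ j i l
    minor₁≗₂ i l = trans (sym (minor≗₁ i l)) (M≗M₂ (suc i) (punchIn j l) (punchInᵢ≢i j l))
  ... | no j≢p = begin
    M zero j * det n (minor M j)
      ≡⟨ cong (M zero j *_) (det-linearCol n (punchOut j≢p) (minor M j) (minor M₁ j) (minor M₂ j)
           (λ i l l≢ → M≗M₁ (suc i) (punchIn j l) (punchIn≢ j≢p l l≢))
           (λ i l l≢ → M≗M₂ (suc i) (punchIn j l) (punchIn≢ j≢p l l≢))
           (λ i → subst (λ q → M (suc i) q ≡ M₁ (suc i) q + M₂ (suc i) q)
                        (sym (punchIn-punchOut j≢p)) (Mp (suc i)))) ⟩
    M zero j * (det n (minor M₁ j) + det n (minor M₂ j))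
      ≡⟨ ℤₚ.*-distribˡ-+ (M zero j) _ _ ⟩
    M zero j * det n (minor M₁ j) + M zero j * det n (minor M₂ j)
      ≡⟨ cong₂ (λ a b → a * det n (minor M₁ j) + b * det n (minor M₂ j))
               (M≗M₁ zero j j≢p) (M≗M₂ zero j j≢p) ⟩
    term₁ M₁ j + term₁ M₂ j ∎
    where open ≡-Reasoning

det-zeroCol : ∀ n (p : Fin n) (M : Mat n) → (∀ i → M i p ≡ + 0) → det n M ≡ + 0
det-zeroCol (suc n) p M Mp≡0 = altSumFin-zero (suc n) _ term
  where
  term : ∀ j → M zero j * det n (minor M j) ≡ + 0
  term j with j ≟ p
  ... | yes refl = cong (_* det n (minor M j)) (Mp≡0 zero)
  ... | no j≢p   = trans (cong (M zero j *_) (det-zeroCol n (punchOut j≢p) (minor M j)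
                     (λ i → subst (λ q → M (suc i) q ≡ + 0) (sym (punchIn-punchOut j≢p)) (Mp≡0 (suc i)))))
                   (ℤₚ.*-zeroʳ (M zero j))

det-equalRows₀₁ : ∀ n (M : Mat (suc (suc n))) → (∀ l → M zero l ≡ M (suc zero) l) →
                  det (suc (suc n)) M ≡ + 0
det-equalRows₀₁ n M rows≡ =
  self-negation (trans (sym (det-cong (suc (suc n)) swap-fixes)) (det-swapRows₀ n M))
  where
  self-negation : ∀ {x} → x ≡ - x → x ≡ + 0
  self-negation {+ zero} _ = refl
  swap-fixes : ∀ i l → M (swapAdj zero i) l ≡ M i l
  swap-fixes zero          l = sym (rows≡ l)
  swap-fixes (suc zero)    l = rows≡ l
  swap-fixes (suc (suc i)) l = refl

subtractRow₁ : ∀ {n} → Mat (suc (suc n)) → Mat (suc (suc n))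
subtractRow₁ M zero    l = M zero l + - M (suc zero) l
subtractRow₁ M (suc i) l = M (suc i) l

det-subtractRow₁ : ∀ n (M : Mat (suc (suc n))) → det (suc (suc n)) (subtractRow₁ M) ≡ det (suc (suc n)) M
det-subtractRow₁ n M = begin
  altSumFin (suc (suc n)) (λ j → (M zero j + - M (suc zero) j) * d j)
    ≡⟨ altSumFin-cong (suc (suc n)) (λ j → ℤₚ.*-distribʳ-+ (d j) (M zero j) (- M (suc zero) j)) ⟩
  altSumFin (suc (suc n)) (λ j → M zero j * d j + - M (suc zero) j * d j)
    ≡⟨ altSumFin-+ (suc (suc n)) (λ j → M zero j * d j) (λ j → - M (suc zero) j * d j) ⟩
  det (suc (suc n)) M + altSumFin (suc (suc n)) (λ j → - M (suc zero) j * d j)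
    ≡⟨ cong (λ s → det (suc (suc n)) M + s) vanishes ⟩
  det (suc (suc n)) M + + 0
    ≡⟨ ℤₚ.+-identityʳ _ ⟩
  det (suc (suc n)) M ∎
  where
  open ≡-Reasoning
  d : Fin (suc (suc n)) → ℤ
  d j = det (suc n) (minor M j)
  R : Mat (suc (suc n))
  R zero    = M (suc zero)
  R (suc i) = M (suc i)
  vanishes : altSumFin (suc (suc n)) (λ j → - M (suc zero) j * d j) ≡ + 0
  vanishes = begin
    altSumFin (suc (suc n)) (λ j → - M (suc zero) j * d j)
      ≡⟨ altSumFin-cong (suc (suc n)) (λ j → ℤₚ.neg-distribˡ-* (M (suc zero) j) (d j)) ⟨
    altSumFin (suc (suc n)) (λ j → - (M (suc zero) j * d j))
      ≡⟨ altSumFin-neg (suc (suc n)) (λ j → M (suc zero) j * d j) ⟩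
    - det (suc (suc n)) R
      ≡⟨ cong -_ (det-equalRows₀₁ n R (λ l → refl)) ⟩
    + 0 ∎

det-firstRow₂ : ∀ n (M : Mat (suc (suc n))) → (∀ l → M zero (suc (suc l)) ≡ + 0) →
  det (suc (suc n)) M ≡
    M zero zero * det (suc n) (minor M zero) + - (M zero (suc zero) * det (suc n) (minor M (suc zero)))
det-firstRow₂ n M row≡0 = cong (λ s → M zero zero * det (suc n) (minor M zero) + - s)
  (trans (cong (λ s → M zero (suc zero) * det (suc n) (minor M (suc zero)) + - s)
                (altSumFin-zero n _ (λ l → cong (_* det (suc n) (minor M (suc (suc l)))) (row≡0 l))))
         (ℤₚ.+-identityʳ _))

det-firstRow₃ : ∀ n (M : Mat (suc (suc (suc n)))) → (∀ l → M zero (suc (suc (suc l))) ≡ + 0) →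
  det (suc (suc (suc n))) M ≡
    M zero zero * det (suc (suc n)) (minor M zero)
    + - (M zero (suc zero) * det (suc (suc n)) (minor M (suc zero))
         + - (M zero (suc (suc zero)) * det (suc (suc n)) (minor M (suc (suc zero)))))
det-firstRow₃ n M row≡0 = cong (λ s → M zero zero * det (suc (suc n)) (minor M zero) + - s)
  (cong (λ s → M zero (suc zero) * det (suc (suc n)) (minor M (suc zero)) + - s)
    (trans (cong (λ s → M zero (suc (suc zero)) * det (suc (suc n)) (minor M (suc (suc zero))) + - s)
                  (altSumFin-zero n _ (λ l →
                     cong (_* det (suc (suc n)) (minor M (suc (suc (suc l))))) (row≡0 l))))
           (ℤₚ.+-identityʳ _)))

det-zeroCol₁-minors : ∀ n (M : Mat (suc (suc n))) → (∀ i → M (suc i) (suc zero) ≡ + 0) →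
  ∀ l → det (suc n) (minor M (suc (suc l))) ≡ + 0
det-zeroCol₁-minors (suc n) M col≡0 l = det-zeroCol (suc (suc n)) (suc zero) (minor M (suc (suc l))) col≡0

det-unitCol₁ : ∀ n (M : Mat (suc (suc n))) → (∀ i → M (suc i) (suc zero) ≡ + 0) →
  det (suc (suc n)) M ≡ - (M zero (suc zero) * det (suc n) (minor M (suc zero)))
det-unitCol₁ n M col≡0 = begin
  M zero zero * d zero
    + - (M zero (suc zero) * d (suc zero) + - altSumFin n (λ l → M zero (suc (suc l)) * d (suc (suc l))))
    ≡⟨ cong₂ (λ a s → M zero zero * a + - (M zero (suc zero) * d (suc zero) + - s))
             (det-zeroCol (suc n) zero (minor M zero) col≡0)
             (altSumFin-zero n _ (λ l →
                trans (cong (M zero (suc (suc l)) *_) (det-zeroCol₁-minors n M col≡0 l))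
                      (ℤₚ.*-zeroʳ (M zero (suc (suc l)))))) ⟩
  M zero zero * + 0 + - (M zero (suc zero) * d (suc zero) + + 0)
    ≡⟨ cong₂ (λ a b → a + - b) (ℤₚ.*-zeroʳ (M zero zero))
                               (ℤₚ.+-identityʳ (M zero (suc zero) * d (suc zero))) ⟩
  + 0 + - (M zero (suc zero) * d (suc zero))
    ≡⟨ ℤₚ.+-identityˡ _ ⟩
  - (M zero (suc zero) * d (suc zero)) ∎
  where
  open ≡-Reasoning
  d : Fin (suc (suc n)) → ℤ
  d j = det (suc n) (minor M j)

-- The transitive tournament 0 → 1 → 2 → ⋯

transitiveSkew : ∀ {m} → Mat m
transitiveSkew zero    zero    = + 0
transitiveSkew zero    (suc j) = + 1
transitiveSkew (suc i) zero    = -1ℤ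
transitiveSkew (suc i) (suc j) = transitiveSkew i j

transitiveSkew-refl : ∀ {m} (i : Fin m) → transitiveSkew i i ≡ + 0
transitiveSkew-refl zero    = refl
transitiveSkew-refl (suc i) = transitiveSkew-refl i

transitiveSkew-< : ∀ {m} {i j : Fin m} → i < j → transitiveSkew i j ≡ + 1
transitiveSkew-< {i = zero}  {suc j} _         = refl
transitiveSkew-< {i = suc i} {suc j} (s≤s i<j) = transitiveSkew-< i<j

transitiveSkew-> : ∀ {m} {i j : Fin m} → j < i → transitiveSkew i j ≡ -1ℤ
transitiveSkew-> {i = suc i} {zero}  _         = refl
transitiveSkew-> {i = suc i} {suc j} (s≤s j<i) = transitiveSkew-> j<i

bordered : ∀ {m} → (Fin m → ℤ) → (Fin m → ℤ) → Mat (suc m)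
bordered r c zero    zero    = + 0
bordered r c zero    (suc j) = r j
bordered r c (suc i) zero    = c i
bordered r c (suc i) (suc j) = transitiveSkew i j

-- These are the minors of `bordered r c` along its first row.
transitiveMinor : ∀ {n} → Fin (suc n) → (Fin (suc n) → ℤ) → Mat (suc n)
transitiveMinor j c i zero    = c i
transitiveMinor j c i (suc l) = transitiveSkew i (punchIn j l)

minorDet : ∀ n → Fin (suc n) → (Fin (suc n) → ℤ) → ℤ
minorDet n j c = det (suc n) (transitiveMinor j c)

-- Subtracting row 1 from row 0 leaves at most three nonzero entries in row 0, since rows 0 and 1
-- of the transitive skew matrix differ only in columns 0 and 1.
minorDet-suc-zero : ∀ n c →
  minorDet (suc n) zero c ≡
    (c zero + - c (suc zero)) * minorDet n zero (λ i → transitiveSkew i zero) + - minorDet n zero (c ∘ suc)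
minorDet-suc-zero n c = begin
  minorDet (suc n) zero c
    ≡⟨ det-subtractRow₁ n (transitiveMinor zero c) ⟨
  det (suc (suc n)) S
    ≡⟨ det-firstRow₂ n S (λ l → refl) ⟩
  (c zero + - c (suc zero)) * det (suc n) (minor S zero) + - (+ 1 * det (suc n) (minor S (suc zero)))
    ≡⟨ cong₂ (λ a b → (c zero + - c (suc zero)) * a + - b)
             (det-cong (suc n) {minor S zero} {transitiveMinor zero (λ i → transitiveSkew i zero)}
                       (λ i → λ { zero → refl ; (suc l) → refl }))
             (trans (ℤₚ.*-identityˡ _)
                    (det-cong (suc n) {minor S (suc zero)} {transitiveMinor zero (c ∘ suc)}
                              (λ i → λ { zero → refl ; (suc l) → refl }))) ⟩
  (c zero + - c (suc zero)) * minorDet n zero (λ i → transitiveSkew i zero) + - minorDet n zero (c ∘ suc) ∎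
  where
  open ≡-Reasoning
  S = subtractRow₁ (transitiveMinor zero c)

minorDet-suc-one : ∀ n c →
  minorDet (suc n) (suc zero) c ≡
    (c zero + - c (suc zero)) * minorDet n zero (λ _ → -1ℤ) + - minorDet n zero (c ∘ suc)
minorDet-suc-one n c = begin
  minorDet (suc n) (suc zero) c
    ≡⟨ det-subtractRow₁ n (transitiveMinor (suc zero) c) ⟨
  det (suc (suc n)) S
    ≡⟨ det-firstRow₂ n S (λ l → refl) ⟩
  (c zero + - c (suc zero)) * det (suc n) (minor S zero) + - (+ 1 * det (suc n) (minor S (suc zero)))
    ≡⟨ cong₂ (λ a b → (c zero + - c (suc zero)) * a + - b)
             (det-cong (suc n) {minor S zero} {transitiveMinor zero (λ _ → -1ℤ)}
                       (λ i → λ { zero → refl ; (suc l) → refl }))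
             (trans (ℤₚ.*-identityˡ _)
                    (det-cong (suc n) {minor S (suc zero)} {transitiveMinor zero (c ∘ suc)}
                              (λ i → λ { zero → refl ; (suc l) → refl }))) ⟩
  (c zero + - c (suc zero)) * minorDet n zero (λ _ → -1ℤ) + - minorDet n zero (c ∘ suc) ∎
  where
  open ≡-Reasoning
  S = subtractRow₁ (transitiveMinor (suc zero) c)

minorDet-suc-suc : ∀ n j c →
  minorDet (suc (suc n)) (suc (suc j)) c ≡
    (c zero + - c (suc zero)) * minorDet (suc n) (suc j) (λ _ → -1ℤ) + minorDet n j (λ i → c (suc (suc i)))
minorDet-suc-suc n j c = begin
  minorDet (suc (suc n)) (suc (suc j)) c
    ≡⟨ det-subtractRow₁ (suc n) (transitiveMinor (suc (suc j)) c) ⟨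
  det (suc (suc (suc n))) S
    ≡⟨ det-firstRow₃ n S (λ l → refl) ⟩
  (c zero + - c (suc zero)) * det (suc (suc n)) (minor S zero)
    + - (+ 1 * det (suc (suc n)) (minor S (suc zero)) + - (+ 1 * det (suc (suc n)) (minor S (suc (suc zero)))))
    ≡⟨ cong₃ (λ a b d → (c zero + - c (suc zero)) * a + - (+ 1 * b + - (+ 1 * d))) minor₀ minor₁ minor₂ ⟩
  (c zero + - c (suc zero)) * D₀ + - (+ 1 * D₁ + - (+ 1 * (D₁ + - (-1ℤ * D₂))))
    ≡⟨ simplify (c zero + - c (suc zero)) D₀ D₁ D₂ ⟩
  (c zero + - c (suc zero)) * D₀ + D₂ ∎
  where
  open ≡-Reasoning
  S = subtractRow₁ (transitiveMinor (suc (suc j)) c)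
  D₀ = minorDet (suc n) (suc j) (λ _ → -1ℤ)
  D₁ = minorDet (suc n) (suc j) (c ∘ suc)
  D₂ = minorDet n j (λ i → c (suc (suc i)))
  minor₀ : det (suc (suc n)) (minor S zero) ≡ D₀
  minor₀ = det-cong (suc (suc n)) {minor S zero} {transitiveMinor (suc j) (λ _ → -1ℤ)}
                    (λ i → λ { zero → refl ; (suc l) → refl })
  minor₁ : det (suc (suc n)) (minor S (suc zero)) ≡ D₁
  minor₁ = det-cong (suc (suc n)) {minor S (suc zero)} {transitiveMinor (suc j) (c ∘ suc)}
                    (λ i → λ { zero → refl ; (suc l) → refl })
  -- column 1 of minor S 2 is constant -1, split as column 0 of the transitive matrix plus a unit column
  unit : Fin (suc (suc n)) → ℤ
  unit zero    = -1ℤ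
  unit (suc i) = + 0
  Z : Mat (suc (suc n))
  Z i zero          = c (suc i)
  Z i (suc zero)    = unit i
  Z i (suc (suc l)) = transitiveSkew i (suc (punchIn j l))
  detZ : det (suc (suc n)) Z ≡ - (-1ℤ * D₂)
  detZ = trans (det-unitCol₁ n Z (λ i → refl))
               (cong (λ d → - (-1ℤ * d))
                     (det-cong (suc n) {minor Z (suc zero)} {transitiveMinor j (λ i → c (suc (suc i)))}
                               (λ i → λ { zero → refl ; (suc l) → refl })))
  minor₂ : det (suc (suc n)) (minor S (suc (suc zero))) ≡ D₁ + - (-1ℤ * D₂)
  minor₂ = trans (det-linearCol (suc (suc n)) (suc zero) (minor S (suc (suc zero)))
                                (transitiveMinor (suc j) (c ∘ suc)) Z
                   (λ i → λ { zero _ → refl ; (suc zero) 1≢1 → contradiction refl 1≢1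
                            ; (suc (suc l)) _ → refl })
                   (λ i → λ { zero _ → refl ; (suc zero) 1≢1 → contradiction refl 1≢1
                            ; (suc (suc l)) _ → refl })
                   (λ { zero → refl ; (suc i) → refl }))
                 (cong (λ z → D₁ + z) detZ)
  simplify : ∀ x d₀ d₁ d₂ → x * d₀ + - (+ 1 * d₁ + - (+ 1 * (d₁ + - (-1ℤ * d₂)))) ≡ x * d₀ + d₂
  simplify = solve-∀
  cong₃ : ∀ (f : ℤ → ℤ → ℤ → ℤ) {a b d a′ b′ d′} → a ≡ a′ → b ≡ b′ → d ≡ d′ → f a b d ≡ f a′ b′ d′
  cong₃ f refl refl refl = refl

altSumFin-transitiveColumn₀ : ∀ n →
  altSumFin (suc n) (λ i → transitiveSkew i zero) ≡ - altSumFin n (λ _ → -1ℤ)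
altSumFin-transitiveColumn₀ n = ℤₚ.+-identityˡ _

minorDet-zero-even : ∀ {n} → Even n → ∀ c → minorDet n zero c ≡ altSumFin (suc n) c
minorDet-zero-odd  : ∀ {n} → Odd n → ∀ c → minorDet n zero c ≡ altSumFin (suc n) c + - c zero

minorDet-zero-even zero c = cong (_+ + 0) (ℤₚ.*-identityʳ (c zero))
minorDet-zero-even {suc n} (suc o) c = begin
  minorDet (suc n) zero c
    ≡⟨ minorDet-suc-zero n c ⟩
  (c zero + - c (suc zero)) * minorDet n zero (λ i → transitiveSkew i zero) + - minorDet n zero (c ∘ suc)
    ≡⟨ cong₂ (λ a b → (c zero + - c (suc zero)) * a + - b)
             (trans (minorDet-zero-odd o (λ i → transitiveSkew i zero))
                    (cong (λ s → s + - + 0) (trans (altSumFin-transitiveColumn₀ n)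
                                                   (cong -_ (altSumFin-const-odd o -1ℤ)))))
             (minorDet-zero-odd o (c ∘ suc)) ⟩
  (c zero + - c (suc zero)) * (- -1ℤ + - + 0) + - (altSumFin (suc n) (c ∘ suc) + - c (suc zero))
    ≡⟨ simplify (c zero) (c (suc zero)) (altSumFin (suc n) (c ∘ suc)) ⟩
  altSumFin (suc (suc n)) c ∎
  where
  open ≡-Reasoning
  simplify : ∀ c₀ c₁ s → (c₀ + - c₁) * (- -1ℤ + - + 0) + - (s + - c₁) ≡ c₀ + - s
  simplify = solve-∀

minorDet-zero-odd {suc n} (suc e) c = begin
  minorDet (suc n) zero c
    ≡⟨ minorDet-suc-zero n c ⟩
  (c zero + - c (suc zero)) * minorDet n zero (λ i → transitiveSkew i zero) + - minorDet n zero (c ∘ suc)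
    ≡⟨ cong₂ (λ a b → (c zero + - c (suc zero)) * a + - b)
             (trans (minorDet-zero-even e (λ i → transitiveSkew i zero))
                    (trans (altSumFin-transitiveColumn₀ n) (cong -_ (altSumFin-const-even e -1ℤ))))
             (minorDet-zero-even e (c ∘ suc)) ⟩
  (c zero + - c (suc zero)) * - + 0 + - altSumFin (suc n) (c ∘ suc)
    ≡⟨ simplify (c zero) (c (suc zero)) (altSumFin (suc n) (c ∘ suc)) ⟩
  altSumFin (suc (suc n)) c + - c zero ∎
  where
  open ≡-Reasoning
  simplify : ∀ c₀ c₁ s → (c₀ + - c₁) * - + 0 + - s ≡ (c₀ + - s) + - c₀
  simplify = solve-∀

minorDet-odd-const : ∀ {n} → Odd n → ∀ j → minorDet n j (λ _ → -1ℤ) ≡ + 1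
minorDet-odd-const {n} o zero = begin
  minorDet n zero (λ _ → -1ℤ)                ≡⟨ minorDet-zero-odd o (λ _ → -1ℤ) ⟩
  altSumFin (suc n) (λ _ → -1ℤ) + - -1ℤ      ≡⟨ cong (λ s → s + - -1ℤ) (altSumFin-const-even (suc o) -1ℤ) ⟩
  + 1                                         ∎
  where open ≡-Reasoning
minorDet-odd-const {suc n} (suc e) (suc zero) = begin
  minorDet (suc n) (suc zero) (λ _ → -1ℤ)
    ≡⟨ minorDet-suc-one n (λ _ → -1ℤ) ⟩
  (-1ℤ + - -1ℤ) * minorDet n zero (λ _ → -1ℤ) + - minorDet n zero (λ _ → -1ℤ)
    ≡⟨ cong (λ d → (-1ℤ + - -1ℤ) * d + - d)
            (trans (minorDet-zero-even e (λ _ → -1ℤ)) (altSumFin-const-odd (suc e) -1ℤ)) ⟩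
  + 1 ∎
  where open ≡-Reasoning
minorDet-odd-const {suc (suc n)} (suc (suc o)) (suc (suc j)) = begin
  minorDet (suc (suc n)) (suc (suc j)) (λ _ → -1ℤ)
    ≡⟨ minorDet-suc-suc n j (λ _ → -1ℤ) ⟩
  (-1ℤ + - -1ℤ) * minorDet (suc n) (suc j) (λ _ → -1ℤ) + minorDet n j (λ _ → -1ℤ)
    ≡⟨ cong (λ d → + 0 * minorDet (suc n) (suc j) (λ _ → -1ℤ) + d) (minorDet-odd-const o j) ⟩
  + 1 ∎
  where open ≡-Reasoning

minorDet-even : ∀ {n} → Even n → ∀ j c → minorDet n j c ≡ altSumFin (suc n) c
minorDet-even e zero c = minorDet-zero-even e c
minorDet-even {suc n} (suc o) (suc zero) c = begin
  minorDet (suc n) (suc zero) c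
    ≡⟨ minorDet-suc-one n c ⟩
  (c zero + - c (suc zero)) * minorDet n zero (λ _ → -1ℤ) + - minorDet n zero (c ∘ suc)
    ≡⟨ cong₂ (λ a b → (c zero + - c (suc zero)) * a + - b)
             (minorDet-odd-const o zero) (minorDet-zero-odd o (c ∘ suc)) ⟩
  (c zero + - c (suc zero)) * + 1 + - (altSumFin (suc n) (c ∘ suc) + - c (suc zero))
    ≡⟨ simplify (c zero) (c (suc zero)) (altSumFin (suc n) (c ∘ suc)) ⟩
  altSumFin (suc (suc n)) c ∎
  where
  open ≡-Reasoning
  simplify : ∀ c₀ c₁ s → (c₀ + - c₁) * + 1 + - (s + - c₁) ≡ c₀ + - s
  simplify = solve-∀
minorDet-even {suc (suc n)} (suc (suc e)) (suc (suc j)) c = begin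
  minorDet (suc (suc n)) (suc (suc j)) c
    ≡⟨ minorDet-suc-suc n j c ⟩
  (c zero + - c (suc zero)) * minorDet (suc n) (suc j) (λ _ → -1ℤ) + minorDet n j (λ i → c (suc (suc i)))
    ≡⟨ cong₂ (λ a b → (c zero + - c (suc zero)) * a + b)
             (minorDet-odd-const (suc e) (suc j)) (minorDet-even e j (λ i → c (suc (suc i)))) ⟩
  (c zero + - c (suc zero)) * + 1 + altSumFin (suc n) (λ i → c (suc (suc i)))
    ≡⟨ simplify (c zero) (c (suc zero)) (altSumFin (suc n) (λ i → c (suc (suc i)))) ⟩
  altSumFin (suc (suc (suc n))) c ∎
  where
  open ≡-Reasoning
  simplify : ∀ c₀ c₁ s → (c₀ + - c₁) * + 1 + s ≡ c₀ + - (c₁ + - s)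
  simplify = solve-∀

det-bordered : ∀ {n} → Even n → ∀ r c →
  det (suc (suc n)) (bordered r c) ≡ - (altSumFin (suc n) r * altSumFin (suc n) c)
det-bordered {n} e r c = begin
  + 0 * det (suc n) (minor (bordered r c) zero)
    + - altSumFin (suc n) (λ j → r j * det (suc n) (minor (bordered r c) (suc j)))
    ≡⟨ ℤₚ.+-identityˡ _ ⟩
  - altSumFin (suc n) (λ j → r j * det (suc n) (minor (bordered r c) (suc j)))
    ≡⟨ cong -_ (altSumFin-cong (suc n) (λ j → cong (r j *_) (minor≡ j))) ⟩
  - altSumFin (suc n) (λ j → r j * altSumFin (suc n) c)
    ≡⟨ cong -_ (altSumFin-cong (suc n) (λ j → ℤₚ.*-comm (r j) (altSumFin (suc n) c))) ⟩
  - altSumFin (suc n) (λ j → altSumFin (suc n) c * r j)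
    ≡⟨ cong -_ (altSumFin-*ˡ (suc n) (altSumFin (suc n) c) r) ⟩
  - (altSumFin (suc n) c * altSumFin (suc n) r)
    ≡⟨ cong -_ (ℤₚ.*-comm _ (altSumFin (suc n) r)) ⟩
  - (altSumFin (suc n) r * altSumFin (suc n) c) ∎
  where
  open ≡-Reasoning
  minor≡ : ∀ j → det (suc n) (minor (bordered r c) (suc j)) ≡ altSumFin (suc n) c
  minor≡ j = trans (det-cong (suc n) {minor (bordered r c) (suc j)} {transitiveMinor j c}
                             (λ i → λ { zero → refl ; (suc l) → refl }))
                   (minorDet-even e j c)

-- Sign sequences

sign : Bool → ℤ
sign true  = + 1
sign false = -1ℤ

altSum : List Bool → ℤ
altSum []       = + 0
altSum (b ∷ bs) = sign b + - altSum bs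

count : Bool → List Bool → ℕ
count _     []           = 0
count true  (true  ∷ bs) = suc (count true bs)
count false (false ∷ bs) = suc (count false bs)
count true  (false ∷ bs) = count true bs
count false (true  ∷ bs) = count false bs

count-true+false : ∀ bs → count true bs ℕ.+ count false bs ≡ length bs
count-true+false []           = refl
count-true+false (true  ∷ bs) = cong suc (count-true+false bs)
count-true+false (false ∷ bs) = trans (ℕₚ.+-suc (count true bs) _) (cong suc (count-true+false bs))

twist : Bool → List Bool → List Bool
twist φ []       = []
twist φ (b ∷ bs) = (φ xor b) ∷ twist (not φ) bs

length-twist : ∀ φ bs → length (twist φ bs) ≡ length bs
length-twist φ []       = refl
length-twist φ (b ∷ bs) = cong suc (length-twist (not φ) bs)

signSum : List Bool → ℤ
signSum bs = + count true bs + - + count false bs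

signSum-∷ : ∀ b bs → signSum (b ∷ bs) ≡ sign b + signSum bs
signSum-∷ true  bs = lemma (+ count true bs) (+ count false bs)
  where
  lemma : ∀ p q → (+ 1 + p) + - q ≡ + 1 + (p + - q)
  lemma = solve-∀
signSum-∷ false bs = lemma (+ count true bs) (+ count false bs)
  where
  lemma : ∀ p q → p + - (+ 1 + q) ≡ -1ℤ + (p + - q)
  lemma = solve-∀

sign-not : ∀ b → sign (not b) ≡ - sign b
sign-not true  = refl
sign-not false = refl

altSum-twist     : ∀ bs → altSum bs ≡ signSum (twist false bs)
neg-altSum-twist : ∀ bs → - altSum bs ≡ signSum (twist true bs)

altSum-twist []       = refl
altSum-twist (b ∷ bs) =
  trans (cong (λ s → sign b + s) (neg-altSum-twist bs)) (sym (signSum-∷ b (twist true bs)))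

neg-altSum-twist []       = refl
neg-altSum-twist (b ∷ bs) = begin
  - (sign b + - altSum bs)                 ≡⟨ ℤₚ.neg-distrib-+ (sign b) (- altSum bs) ⟩
  - sign b + - - altSum bs                 ≡⟨ cong₂ _+_ (sym (sign-not b)) (ℤₚ.neg-involutive (altSum bs)) ⟩
  sign (not b) + altSum bs                 ≡⟨ cong (λ s → sign (not b) + s) (altSum-twist bs) ⟩
  sign (not b) + signSum (twist false bs)  ≡⟨ signSum-∷ (not b) (twist false bs) ⟨
  signSum (not b ∷ twist false bs)         ∎
  where open ≡-Reasoning

changes : Bool → List Bool → ℕ
changes b     []           = 0
changes true  (true  ∷ cs) = changes true cs
changes false (false ∷ cs) = changes false cs
changes true  (false ∷ cs) = suc (changes false cs)
changes false (true  ∷ cs) = suc (changes true cs)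

length-runsAux : ∀ b k cs → length (runsAux b k cs) ≡ suc (changes b cs)
length-runsAux b     k []           = refl
length-runsAux true  k (true  ∷ cs) = length-runsAux true (suc k) cs
length-runsAux false k (false ∷ cs) = length-runsAux false (suc k) cs
length-runsAux true  k (false ∷ cs) = cong suc (length-runsAux false zero cs)
length-runsAux false k (true  ∷ cs) = cong suc (length-runsAux true zero cs)

-- Each adjacent pair changes value either in the list or in its twist, never in both.
changes-twist : ∀ φ b cs → changes b cs ℕ.+ changes (φ xor b) (twist (not φ) cs) ≡ length cs
changes-twist φ     b     []           = refl
changes-twist false true  (true  ∷ cs) = trans (ℕₚ.+-suc _ _) (cong suc (changes-twist true true cs))
changes-twist false false (false ∷ cs) = trans (ℕₚ.+-suc _ _) (cong suc (changes-twist true false cs))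
changes-twist false true  (false ∷ cs) = cong suc (changes-twist true false cs)
changes-twist false false (true  ∷ cs) = cong suc (changes-twist true true cs)
changes-twist true  true  (true  ∷ cs) = trans (ℕₚ.+-suc _ _) (cong suc (changes-twist false true cs))
changes-twist true  false (false ∷ cs) = trans (ℕₚ.+-suc _ _) (cong suc (changes-twist false false cs))
changes-twist true  true  (false ∷ cs) = cong suc (changes-twist false false cs)
changes-twist true  false (true  ∷ cs) = cong suc (changes-twist false true cs)

changes≡0⇔count-not≡0 : ∀ b cs → changes b cs ≡ 0 ⇔ count (not b) cs ≡ 0
changes≡0⇔count-not≡0 b     []           = mk⇔ (λ _ → refl) (λ _ → refl)
changes≡0⇔count-not≡0 true  (true  ∷ cs) = changes≡0⇔count-not≡0 true cs
changes≡0⇔count-not≡0 false (false ∷ cs) = changes≡0⇔count-not≡0 false cs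
changes≡0⇔count-not≡0 true  (false ∷ cs) = mk⇔ (λ ()) (λ ())
changes≡0⇔count-not≡0 false (true  ∷ cs) = mk⇔ (λ ()) (λ ())

count-product≡0⇔ : ∀ b cs →
  count true (b ∷ cs) ℕ.* count false (b ∷ cs) ≡ 0 ⇔ count (not b) cs ≡ 0
count-product≡0⇔ true  cs = mk⇔
  (λ eq → ℕₚ.m*n≡0⇒m≡0 (count false cs) (suc (count true cs)) (trans (ℕₚ.*-comm (count false cs) _) eq))
  (λ eq → trans (cong (suc (count true cs) ℕ.*_) eq) (ℕₚ.*-zeroʳ (suc (count true cs))))
count-product≡0⇔ false cs = mk⇔
  (ℕₚ.m*n≡0⇒m≡0 (count true cs) (suc (count false cs)))
  (cong (ℕ._* suc (count false cs)))

m+n≡l⇒n≡0⇔m≡l : ∀ {m n l} → m ℕ.+ n ≡ l → n ≡ 0 ⇔ m ≡ l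
m+n≡l⇒n≡0⇔m≡l {m} {n} m+n≡l = mk⇔
  (λ n≡0 → trans (sym (trans (cong (m ℕ.+_) n≡0) (ℕₚ.+-identityʳ m))) m+n≡l)
  (λ m≡l → ℕₚ.+-cancelˡ-≡ m n 0 (trans m+n≡l (trans (sym m≡l) (sym (ℕₚ.+-identityʳ m)))))

length²≡altSum²+4pq : ∀ bs →
  + length bs * + length bs ≡
    altSum bs * altSum bs + + (4 ℕ.* (count true (twist false bs) ℕ.* count false (twist false bs)))
length²≡altSum²+4pq bs = begin
  + length bs * + length bs
    ≡⟨ cong (λ l → + l * + l) (trans (sym (length-twist false bs)) (sym (count-true+false ts))) ⟩
  + (p ℕ.+ q) * + (p ℕ.+ q)
    ≡⟨ cong₂ _*_ (ℤₚ.pos-+ p q) (ℤₚ.pos-+ p q) ⟩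
  (+ p + + q) * (+ p + + q)
    ≡⟨ square-sum (+ p) (+ q) ⟩
  (+ p + - + q) * (+ p + - + q) + + 4 * (+ p * + q)
    ≡⟨ cong₂ (λ s k → s * s + k) (sym (altSum-twist bs))
             (trans (cong (+ 4 *_) (sym (ℤₚ.pos-* p q))) (sym (ℤₚ.pos-* 4 (p ℕ.* q)))) ⟩
  altSum bs * altSum bs + + (4 ℕ.* (p ℕ.* q)) ∎
  where
  open ≡-Reasoning
  ts = twist false bs
  p = count true ts
  q = count false ts
  square-sum : ∀ p q → (p + q) * (p + q) ≡ (p + - q) * (p + - q) + + 4 * (p * q)
  square-sum = solve-∀

altSum²≤length² : ∀ bs → altSum bs * altSum bs ≤ + length bs * + length bs
altSum²≤length² bs = subst (altSum bs * altSum bs ≤_) (sym (length²≡altSum²+4pq bs)) (ℤₚ.i≤i+j _ _)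

altSum²≡length²⇔pq≡0 : ∀ bs →
  altSum bs * altSum bs ≡ + length bs * + length bs ⇔
  count true (twist false bs) ℕ.* count false (twist false bs) ≡ 0
altSum²≡length²⇔pq≡0 bs = mk⇔
  (λ eq → ℕₚ.m*n≡0⇒m≡0 pq 4 (trans (ℕₚ.*-comm pq 4)
            (ℤₚ.+-injective (+-identityʳ-unique (x * x) (+ (4 ℕ.* pq))
              (trans (sym (length²≡altSum²+4pq bs)) (sym eq))))))
  (λ pq≡0 → trans (sym (ℤₚ.+-identityʳ (x * x)))
                  (trans (cong (λ k → x * x + + (4 ℕ.* k)) (sym pq≡0)) (sym (length²≡altSum²+4pq bs))))
  where
  x = altSum bs
  pq = count true (twist false bs) ℕ.* count false (twist false bs)

altSum²≡length²⇔length-runs≡length : ∀ bs →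
  altSum bs * altSum bs ≡ + length bs * + length bs ⇔ length (runs bs) ≡ length bs
altSum²≡length²⇔length-runs≡length []       = mk⇔ (λ _ → refl) (λ _ → refl)
altSum²≡length²⇔length-runs≡length (b ∷ cs) =
  ⇔-trans (altSum²≡length²⇔pq≡0 (b ∷ cs)) (⇔-trans (count-product≡0⇔ b (twist true cs))
  (⇔-trans (⇔-sym (changes≡0⇔count-not≡0 b (twist true cs)))
  (⇔-trans (m+n≡l⇒n≡0⇔m≡l (changes-twist false b cs))
           (mk⇔ (λ eq → trans (length-runsAux b zero cs) (cong suc eq))
                (λ eq → ℕₚ.suc-injective (trans (sym (length-runsAux b zero cs)) eq))))))

-- Tournaments

altSumFin-finList : ∀ m (f : Fin m → Bool) → altSumFin m (sign ∘ f) ≡ altSum (finList m f)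
altSumFin-finList ℕ.zero    f = refl
altSumFin-finList (ℕ.suc m) f = cong (λ s → sign (f zero) + - s) (altSumFin-finList m (f ∘ suc))

length-finList : ∀ m {A : Set} (f : Fin m → A) → length (finList m f) ≡ m
length-finList ℕ.zero    f = refl
length-finList (ℕ.suc m) f = cong suc (length-finList m (f ∘ suc))

inFirst-fromℕ : ∀ m → inFirst (fromℕ m) ≡ false
inFirst-fromℕ ℕ.zero    = refl
inFirst-fromℕ (ℕ.suc m) = inFirst-fromℕ m

module _ {n} {T : Fin n → Fin n → Bool} (tournament : IsTournament T) where
  open IsTournament tournament

  skew-irrefl : ∀ x → skew T x x ≡ + 0
  skew-irrefl x rewrite irrefl x = refl

  skew≡sign : ∀ {x y} → x ≢ y → skew T x y ≡ sign (T x y)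
  skew≡sign {x} {y} x≢y with T x y | oneArc y x (x≢y ∘ sym)
  ... | true  | _         = refl
  ... | false | Tyx≡true rewrite Tyx≡true = refl

  skew-antisym : ∀ {x y} → x ≢ y → skew T y x ≡ - skew T x y
  skew-antisym {x} {y} x≢y = begin
    skew T y x         ≡⟨ skew≡sign (x≢y ∘ sym) ⟩
    sign (T y x)       ≡⟨ cong sign (oneArc y x (x≢y ∘ sym)) ⟩
    sign (not (T x y)) ≡⟨ sign-not (T x y) ⟩
    - sign (T x y)     ≡⟨ cong -_ (skew≡sign x≢y) ⟨
    - skew T x y       ∎
    where open ≡-Reasoning

module _ {m} {T : Fin (suc m) → Fin (suc m) → Bool} (tournament : IsTournament T)
         (σ : Fin m → Fin (suc m)) (σ∈X : ∀ a → inFirst (σ a) ≡ true)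
         (σ-ordered : ∀ a b → a < b → T (σ a) (σ b) ≡ true) where
  open IsTournament tournament
  open ≡-Reasoning

  private
    u : Fin (suc m)
    u = fromℕ m

  σ-<⇒≢ : ∀ {a b} → a < b → σ a ≢ σ b
  σ-<⇒≢ {a} {b} a<b σa≡σb
    with () ← trans (sym (subst (λ x → T x (σ b) ≡ true) σa≡σb (σ-ordered a b a<b))) (irrefl (σ b))

  σ-injective : Injective _≡_ _≡_ σ
  σ-injective {a} {b} σa≡σb with <-cmp a b
  ... | tri< a<b _ _ = contradiction σa≡σb (σ-<⇒≢ a<b)
  ... | tri≈ _ a≡b _ = a≡b
  ... | tri> _ _ b<a = contradiction (sym σa≡σb) (σ-<⇒≢ b<a)

  σ≢u : ∀ a → σ a ≢ u
  σ≢u a σa≡u with () ← trans (sym (σ∈X a)) (trans (cong inFirst σa≡u) (inFirst-fromℕ m))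

  order : Fin (suc m) → Fin (suc m)
  order zero    = u
  order (suc a) = σ a

  order-injective : Injective _≡_ _≡_ order
  order-injective {zero}  {zero}  _  = refl
  order-injective {zero}  {suc b} eq = contradiction (sym eq) (σ≢u b)
  order-injective {suc a} {zero}  eq = contradiction eq (σ≢u a)
  order-injective {suc a} {suc b} eq = cong suc (σ-injective eq)

  skew-σ : ∀ a b → skew T (σ a) (σ b) ≡ transitiveSkew a b
  skew-σ a b with <-cmp a b
  ... | tri< a<b _ _ = begin
    skew T (σ a) (σ b)      ≡⟨ skew≡sign tournament (σ-<⇒≢ a<b) ⟩
    sign (T (σ a) (σ b))    ≡⟨ cong sign (σ-ordered a b a<b) ⟩
    + 1                     ≡⟨ transitiveSkew-< a<b ⟨
    transitiveSkew a b      ∎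
  ... | tri≈ _ refl _ = trans (skew-irrefl tournament (σ a)) (sym (transitiveSkew-refl a))
  ... | tri> _ _ b<a = begin
    skew T (σ a) (σ b)      ≡⟨ skew-antisym tournament (σ-<⇒≢ b<a) ⟩
    - skew T (σ b) (σ a)    ≡⟨ cong -_ (skew≡sign tournament (σ-<⇒≢ b<a)) ⟩
    - sign (T (σ b) (σ a))  ≡⟨ cong (-_ ∘ sign) (σ-ordered b a b<a) ⟩
    -1ℤ                     ≡⟨ transitiveSkew-> b<a ⟨
    transitiveSkew a b      ∎

  arcSigns : Fin m → ℤ
  arcSigns a = sign (T u (σ a))

  skew-order : ∀ i j → skew T (order i) (order j) ≡ bordered arcSigns (λ a → - arcSigns a) i j
  skew-order zero    zero    = skew-irrefl tournament u
  skew-order zero    (suc b) = skew≡sign tournament (σ≢u b ∘ sym)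
  skew-order (suc a) zero    =
    trans (skew-antisym tournament (σ≢u a ∘ sym)) (cong -_ (skew≡sign tournament (σ≢u a ∘ sym)))
  skew-order (suc a) (suc b) = skew-σ a b

  detT≡det-bordered : detT T ≡ det (suc m) (bordered arcSigns (λ a → - arcSigns a))
  detT≡det-bordered = trans (sym (det-conj-injective (suc m) order order-injective (skew T)))
                            (det-cong (suc m) skew-order)

proposition4p5 : (m : ℕ) → 2 ∣ suc m →
    (T : Fin (suc m) → Fin (suc m) → Bool) → IsTournament T →
    TransitiveOn inFirst T →
    (σ : Fin m → Fin (suc m)) →
    (∀ a → inFirst (σ a) ≡ true) →
    (∀ a b → a < b → T (σ a) (σ b) ≡ true) →
    (detT T ≤ (+ m) *ℤ (+ m)) ×
    (detT T ≡ (+ m) *ℤ (+ m) ⇔ length (psi m T (fromℕ m) σ) ≡ m)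
proposition4p5 ℕ.zero 2∣1 _ _ _ _ _ _ with suc () ← 2∣⇒Even 2∣1
proposition4p5 m@(ℕ.suc n) 2∣m+1 T tournament _ σ σ∈X σ-ordered
  with suc (suc n-even) ← 2∣⇒Even 2∣m+1 =
  subst (λ d → (d ≤ + m *ℤ + m) × (d ≡ + m *ℤ + m ⇔ length (runs xs) ≡ m)) (sym detT≡x²)
    (subst (λ l → (x * x ≤ + l * + l) × (x * x ≡ + l * + l ⇔ length (runs xs) ≡ l)) (length-finList m f)
      (altSum²≤length² xs , altSum²≡length²⇔length-runs≡length xs))
  where
  open ≡-Reasoning
  f : Fin m → Bool
  f a = T (fromℕ m) (σ a)
  xs = finList m f
  x = altSum xs
  s = altSumFin m (sign ∘ f)
  detT≡x² : detT T ≡ x * x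
  detT≡x² = begin
    detT T
      ≡⟨ detT≡det-bordered tournament σ σ∈X σ-ordered ⟩
    det (suc m) (bordered (sign ∘ f) (λ a → - sign (f a)))
      ≡⟨ det-bordered n-even (sign ∘ f) (λ a → - sign (f a)) ⟩
    - (s * altSumFin m (λ a → - sign (f a)))
      ≡⟨ cong (λ t → - (s * t)) (altSumFin-neg m (sign ∘ f)) ⟩
    - (s * - s)
      ≡⟨ trans (ℤₚ.neg-distribʳ-* s (- s)) (cong (s *_) (ℤₚ.neg-involutive s)) ⟩
    s * s
      ≡⟨ cong (λ t → t * t) (altSumFin-finList m f) ⟩
    x * x ∎
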